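{- Let $G$ be a graph without isolated vertices, let $F\subseteq\varphi(G)$, and let $Z$ be a nondeterministic read-once branching program representing $F$. Let $u$ be a vertex of $Z$ and let $M=\{\{x_1,y_1\},\dots,\{x_q,y_q\}\}$ be a matching of $G$ such that $\{x_1,\dots,x_q\}$ and $\{y_1,\dots,y_q\}$ are separated by $u$. Then there is a set $X$ of $q$ vertices of $G$ consisting of exactly one vertex of each $\{x_i,y_i\}$ such that for every source-sink path $P$ of $Z$ passing through $u$, $X\subseteq A(P)$ (i.e. every variable of $X$ occurs positively in $A(P)$).
   Context: For a graph $G$ without isolated vertices, $\varphi(G)$ is the CNF with variables $V(G)$ and clauses $(u\vee v)$ for $\{u,v\}\in E(G)$. Boolean functions are identified with their sets of satisfying assignments (sets of literals), and $F\subseteq\varphi(G)$ means every satisfying assignment of $F$ satisfies $\varphi(G)$. A nondeterministic read-once branching program (NROBP) on variable set $V$ is a DAG with one source and one sink, some edges labelled by literals over $V$, such that each variable of $V$ occurs exactly once on each source-sink path; $A(P)$ is the set of literals labelling path $P$, and the NROBP represents the function whose satisfying assignments are the $A(P)$ for source-sink paths $P$. (Any two paths with the same endpoints carry the same set of variables.) A variable $x$ is located before a vertex $u$ of $Z$ if on each source-sink path through $u$, $x$ occurs on the prefix ending at $u$, and after $u$ if it occurs on the suffix starting at $u$. Two sets of variables $X,Y$ are separated by $u$ if either all of $X$ are located before $u$ and all of $Y$ after $u$, or vice versa. -}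

module Defs where

open import Data.Nat using (ℕ; zero; suc)
open import Data.Fin using (Fin; _≟_)
open import Data.Bool using (Bool; true; false)
open import Data.Maybe using (Maybe; just; nothing)
open import Data.List using (List; []; _∷_; _++_)
open import Data.List.Membership.Propositional using (_∈_)
open import Data.Product using (_×_; _,_; proj₁; proj₂; ∃; ∃-syntax; Σ)
open import Data.Sum using (_⊎_)
open import Data.Empty using (⊥)
open import Relation.Nullary using (¬_; yes; no)
open import Relation.Binary.PropositionalEquality using (_≡_; _≢_)
open import Function.Bundles using (_⇔_)

record Graph (n : ℕ) : Set₁ where
  field
    Adj       : Fin n → Fin n → Set
    Adj-sym   : ∀ {u v} → Adj u v → Adj v u
    Adj-irrefl : ∀ {u} → ¬ Adj u u
open Graph public

NoIsolated : ∀ {n} → Graph n → Set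
NoIsolated {n} G = ∀ (v : Fin n) → ∃[ w ] Adj G v w

-- a literal over variables Fin n: (x , true) is x, (x , false) is ¬x
Lit : ℕ → Set
Lit n = Fin n × Bool

-- a (total) assignment of V = Fin n; it corresponds to the set of
-- literals {(x , a x) | x ∈ V}
Assignment : ℕ → Set
Assignment n = Fin n → Bool

-- a Boolean function on V, identified with its set of satisfying assignments
BoolFun : ℕ → Set₁
BoolFun n = Assignment n → Set

φ : ∀ {n} → Graph n → BoolFun n
φ G a = ∀ u v → Adj G u v → (a u ≡ true) ⊎ (a v ≡ true)

_⊆F_ : ∀ {n} → BoolFun n → BoolFun n → Set
F ⊆F H = ∀ a → F a → H a

record BP (n : ℕ) : Set where
  field
    m k    : ℕ
    src    : Fin k → Fin m
    tgt    : Fin k → Fin m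
    lab    : Fin k → Maybe (Lit n)
    source : Fin m
    sink   : Fin m
open BP public

data Path {n} (Z : BP n) : Fin (m Z) → Fin (m Z) → Set where
  []  : ∀ {v} → Path Z v v
  _∷_ : ∀ {v w} (e : Fin (k Z)) → src Z e ≡ v → Path Z (tgt Z e) w → Path Z v w

labels : ∀ {n} {Z : BP n} {v w} → Path Z v w → List (Lit n)
labels [] = []
labels {Z = Z} (_∷_ e _ p) with lab Z e
... | just l  = l ∷ labels p
... | nothing = labels p

occ : ∀ {n} → Fin n → List (Lit n) → ℕ
occ x [] = zero
occ x ((y , _) ∷ ls) with x ≟ y
... | yes _ = suc (occ x ls)
... | no  _ = occ x ls

OccursIn : ∀ {n} → Fin n → List (Lit n) → Set
OccursIn x ls = ∃[ b ] ((x , b) ∈ ls)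

record IsNROBP {n} (Z : BP n) : Set where
  field
    acyclic      : ∀ {v} (e : Fin (k Z)) → src Z e ≡ v → Path Z (tgt Z e) v → ⊥
    source-noIn  : ∀ (e : Fin (k Z)) → tgt Z e ≢ source Z
    source-uniq  : ∀ (v : Fin (m Z)) → (∀ e → tgt Z e ≢ v) → v ≡ source Z
    sink-noOut   : ∀ (e : Fin (k Z)) → src Z e ≢ sink Z
    sink-uniq    : ∀ (v : Fin (m Z)) → (∀ e → src Z e ≢ v) → v ≡ sink Z
    read-once    : ∀ (P : Path Z (source Z) (sink Z)) (x : Fin n) → occ x (labels P) ≡ 1

-- the assignment a is A(P) for the path P (P carries every variable once,
-- so A(P) is the set of literals of a exactly when all literals of P agree with a)
PathGives : ∀ {n} {Z : BP n} {v w} → Path Z v w → Assignment n → Set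
PathGives P a = ∀ l → l ∈ labels P → a (proj₁ l) ≡ proj₂ l

Represents : ∀ {n} → BP n → BoolFun n → Set
Represents Z F = ∀ a → F a ⇔ (Σ (Path Z (source Z) (sink Z)) λ P → PathGives P a)

-- x is located before / after vertex u
-- (source-sink paths through u are pairs of a prefix source→u and suffix u→sink)
Before : ∀ {n} (Z : BP n) → Fin n → Fin (m Z) → Set
Before Z x u = ∀ (P₁ : Path Z (source Z) u) (P₂ : Path Z u (sink Z)) → OccursIn x (labels P₁)

After : ∀ {n} (Z : BP n) → Fin n → Fin (m Z) → Set
After Z x u = ∀ (P₁ : Path Z (source Z) u) (P₂ : Path Z u (sink Z)) → OccursIn x (labels P₂)

Separated : ∀ {n q} (Z : BP n) → (Fin q → Fin n) → (Fin q → Fin n) → Fin (m Z) → Set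
Separated Z xs ys u =
  ((∀ i → Before Z (xs i) u) × (∀ i → After Z (ys i) u)) ⊎
  ((∀ i → After Z (xs i) u) × (∀ i → Before Z (ys i) u))

IsMatching : ∀ {n q} → Graph n → (Fin q → Fin n) → (Fin q → Fin n) → Set
IsMatching {q = q} G xs ys =
  (∀ i → Adj G (xs i) (ys i)) ×
  (∀ i j → xs i ≡ xs j → i ≡ j) ×
  (∀ i j → ys i ≡ ys j → i ≡ j) ×
  (∀ i j → xs i ≢ ys j)

module Submission where

-- Fix an edge {x,y} of the matching with x located before u and
-- y after u (the other orientation is symmetric).  Either some prefix
-- source → u carries the literal ¬x, or none does.
--   * If none does: x occurs on every prefix, necessarily as x, so x is
--     positive on every source-sink path through u.
--   * If the prefix P₁ carries ¬x: for any suffix Q₂, the path P₁Q₂ is a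
--     source-sink path, so A(P₁Q₂) satisfies F ⊆ φ(G) and hence the clause
--     (x ∨ y); as x is false there, y is true, and y occurs on Q₂.  So y is
--     positive on every path through u.
-- Constructively, the case split needs the existence of a prefix carrying ¬x to
-- be decidable.  This holds because Z is acyclic: the vertices of a path are
-- pairwise distinct, so every path has length ≤ |V(Z)|, and paths of bounded
-- length can be searched exhaustively.

open import Defs
open import Data.Nat using (ℕ; zero; suc; pred; _≤_; z≤n; s≤s)
open import Data.Nat.Properties using (≤-trans; n≤1+n)
open import Data.Fin using (Fin; _≟_) renaming (zero to fzero; suc to fsuc)
open import Data.Fin.Properties using (any?; injective⇒≤)
open import Data.Bool using (true; false)
open import Data.Bool.Properties using () renaming (_≟_ to _≟ᵇ_)
open import Data.Maybe using (just; nothing)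
open import Data.Maybe.Properties using () renaming (≡-dec to ≡-decᵐ)
open import Data.Product using (_×_; _,_; Σ; proj₁; proj₂)
open import Data.Product.Properties using () renaming (≡-dec to ≡-decˣ)
open import Data.Sum using (_⊎_; inj₁; inj₂; swap)
open import Data.Empty using (⊥-elim)
open import Data.List using (List; []; _∷_; _++_)
open import Data.List.Relation.Unary.Any using (here; there)
open import Data.List.Membership.Propositional using (_∈_)
open import Data.List.Membership.Propositional.Properties using (∈-++⁺ˡ; ∈-++⁺ʳ)
open import Relation.Nullary using (Dec; yes; no; ¬_)
open import Relation.Nullary.Decidable using (_⊎-dec_; _×-dec_)
open import Relation.Binary.PropositionalEquality using (_≡_; refl; sym; trans; subst; cong)
open import Function.Bundles using (Equivalence)

module _ {n : ℕ} (Z : BP n) where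

  len : ∀ {v w} → Path Z v w → ℕ
  len [] = zero
  len (_∷_ e _ p) = suc (len p)

  _++ᴾ_ : ∀ {u v w} → Path Z u v → Path Z v w → Path Z u w
  [] ++ᴾ q = q
  (_∷_ e eq p) ++ᴾ q = _∷_ e eq (p ++ᴾ q)

  labels-++ : ∀ {u v w} (p : Path Z u v) (q : Path Z v w) →
              labels (p ++ᴾ q) ≡ labels p ++ labels q
  labels-++ [] q = refl
  labels-++ (_∷_ e eq p) q with lab Z e
  ... | just l  = cong (l ∷_) (labels-++ p q)
  ... | nothing = labels-++ p q

  ∈-labels-∷⁻ : ∀ {v w l} e (eq : src Z e ≡ v) (p : Path Z (tgt Z e) w) →
                l ∈ labels (_∷_ e eq p) → (lab Z e ≡ just l) ⊎ (l ∈ labels p)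
  ∈-labels-∷⁻ e eq p l∈ with lab Z e
  ... | nothing = inj₂ l∈
  ... | just _ with l∈
  ...   | here refl = inj₁ refl
  ...   | there l∈p = inj₂ l∈p

  ∈-labels-head : ∀ {v w l} e (eq : src Z e ≡ v) (p : Path Z (tgt Z e) w) →
                  lab Z e ≡ just l → l ∈ labels (_∷_ e eq p)
  ∈-labels-head e eq p h with lab Z e
  ∈-labels-head e eq p refl | just _ = here refl

  ∈-labels-tail : ∀ {v w l} e (eq : src Z e ≡ v) (p : Path Z (tgt Z e) w) →
                  l ∈ labels p → l ∈ labels (_∷_ e eq p)
  ∈-labels-tail e eq p l∈ with lab Z e
  ... | just _  = there l∈
  ... | nothing = l∈

  ShortPath : ℕ → Fin (m Z) → Fin (m Z) → Set
  ShortPath L v w = Σ (Path Z v w) λ p → len p ≤ L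

  ShortPathWith : ℕ → Fin (m Z) → Fin (m Z) → Lit n → Set
  ShortPathWith L v w l = Σ (Path Z v w) λ p → (len p ≤ L) × (l ∈ labels p)

  shortPath? : ∀ L v w → Dec (ShortPath L v w)
  shortPath? zero v w with v ≟ w
  ... | yes refl = yes ([] , z≤n)
  ... | no v≢w   = no λ { ([] , _) → v≢w refl ; (_∷_ e eq p , ()) }
  shortPath? (suc L) v w with v ≟ w
  ... | yes refl = yes ([] , z≤n)
  ... | no v≢w with any? (λ e → (src Z e ≟ v) ×-dec shortPath? L (tgt Z e) w)
  ...   | yes (e , eq , p , p≤L) = yes (_∷_ e eq p , s≤s p≤L)
  ...   | no ¬step = no λ { ([] , _) → v≢w refl
                          ; (_∷_ e eq p , s≤s p≤L) → ¬step (e , eq , p , p≤L) }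

  shortPathWith? : ∀ L v w l → Dec (ShortPathWith L v w l)
  shortPathWith? zero v w l = no λ { ([] , _ , ()) ; (_∷_ e eq p , () , _) }
  shortPathWith? (suc L) v w l with any? (λ e → (src Z e ≟ v) ×-dec
      ((≡-decᵐ (≡-decˣ _≟_ _≟ᵇ_) (lab Z e) (just l) ×-dec shortPath? L (tgt Z e) w)
       ⊎-dec shortPathWith? L (tgt Z e) w l))
  ... | yes (e , eq , inj₁ (e↦l , p , p≤L)) =
          yes (_∷_ e eq p , s≤s p≤L , ∈-labels-head e eq p e↦l)
  ... | yes (e , eq , inj₂ (p , p≤L , l∈p)) =
          yes (_∷_ e eq p , s≤s p≤L , ∈-labels-tail e eq p l∈p)
  ... | no ¬step = no λ { ([] , _ , ())
                        ; (_∷_ e eq p , s≤s p≤L , l∈) → ¬step (e , eq , split e eq p p≤L l∈) }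
    where
      split : ∀ e eq p → len p ≤ L → l ∈ labels (_∷_ e eq p) →
              ((lab Z e ≡ just l) × ShortPath L (tgt Z e) w) ⊎ ShortPathWith L (tgt Z e) w l
      split e eq p p≤L l∈ with ∈-labels-∷⁻ e eq p l∈
      ... | inj₁ e↦l = inj₁ (e↦l , p , p≤L)
      ... | inj₂ l∈p = inj₂ (p , p≤L , l∈p)

  vertexAt : ∀ {v w} (p : Path Z v w) → Fin (suc (len p)) → Fin (m Z)
  vertexAt {v} [] fzero = v
  vertexAt {v} (_∷_ e _ p) fzero = v
  vertexAt (_∷_ e _ p) (fsuc i) = vertexAt p i

  prefixTo : ∀ {v w} (p : Path Z v w) (i : Fin (suc (len p))) → Path Z v (vertexAt p i)
  prefixTo [] fzero = []
  prefixTo (_∷_ e _ p) fzero = []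
  prefixTo (_∷_ e eq p) (fsuc i) = _∷_ e eq (prefixTo p i)

  module _ (N : IsNROBP Z) where
    open IsNROBP N

    vertexAt-injective : ∀ {v w} (p : Path Z v w) {i j} → vertexAt p i ≡ vertexAt p j → i ≡ j
    vertexAt-injective [] {fzero} {fzero} _ = refl
    vertexAt-injective (_∷_ e eq p) {fzero} {fzero} _ = refl
    vertexAt-injective (_∷_ e eq p) {fzero} {fsuc j} v≡ =
      ⊥-elim (acyclic e eq (subst (Path Z (tgt Z e)) (sym v≡) (prefixTo p j)))
    vertexAt-injective (_∷_ e eq p) {fsuc i} {fzero} v≡ =
      ⊥-elim (acyclic e eq (subst (Path Z (tgt Z e)) v≡ (prefixTo p i)))
    vertexAt-injective (_∷_ e eq p) {fsuc i} {fsuc j} v≡ = cong fsuc (vertexAt-injective p v≡)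

    len≤vertices : ∀ {v w} (p : Path Z v w) → len p ≤ m Z
    len≤vertices p = ≤-trans (n≤1+n _) (injective⇒≤ (vertexAt-injective p))

    pathWith? : ∀ v w l → Dec (Σ (Path Z v w) λ p → l ∈ labels p)
    pathWith? v w l with shortPathWith? (m Z) v w l
    ... | yes (p , _ , l∈p) = yes (p , l∈p)
    ... | no ¬short = no λ { (p , l∈p) → ¬short (p , len≤vertices p , l∈p) }

firstValue : ∀ {n} → List (Lit n) → Assignment n
firstValue [] x = false
firstValue ((y , c) ∷ ls) x with x ≟ y
... | yes _ = c
... | no _  = firstValue ls x

occ≡0⇒∉ : ∀ {n} {x : Fin n} {b} ls → occ x ls ≡ 0 → ¬ ((x , b) ∈ ls)
occ≡0⇒∉ {x = x} ((y , c) ∷ ls) occ≡0 x∈ with x ≟ y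
occ≡0⇒∉ {x = x} ((y , c) ∷ ls) () x∈ | yes _
occ≡0⇒∉ {x = x} ((y , c) ∷ ls) occ≡0 (here refl) | no x≢y = x≢y refl
occ≡0⇒∉ {x = x} ((y , c) ∷ ls) occ≡0 (there x∈) | no x≢y = occ≡0⇒∉ ls occ≡0 x∈

firstValue-unique : ∀ {n} {x : Fin n} {b} ls → occ x ls ≡ 1 → (x , b) ∈ ls →
                    firstValue ls x ≡ b
firstValue-unique {x = x} ((y , c) ∷ ls) occ≡1 x∈ with x ≟ y
firstValue-unique {x = x} ((y , c) ∷ ls) occ≡1 (here refl) | yes _ = refl
firstValue-unique {x = x} ((y , c) ∷ ls) occ≡1 (there x∈) | yes _ =
  ⊥-elim (occ≡0⇒∉ ls (cong pred occ≡1) x∈)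
firstValue-unique {x = x} ((y , c) ∷ ls) occ≡1 (here refl) | no x≢y = ⊥-elim (x≢y refl)
firstValue-unique {x = x} ((y , c) ∷ ls) occ≡1 (there x∈) | no x≢y =
  firstValue-unique ls occ≡1 x∈

pathSatisfies : ∀ {n} (F : BoolFun n) (Z : BP n) → IsNROBP Z → Represents Z F →
  (P : Path Z (source Z) (sink Z)) →
  Σ (Assignment n) λ a → F a × (∀ {x b} → (x , b) ∈ labels P → a x ≡ b)
pathSatisfies F Z N rep P = a , Equivalence.from (rep a) (P , agrees) , agrees _
  where
    a : Assignment _
    a = firstValue (labels P)
    agrees : PathGives P a
    agrees (x , b) = firstValue-unique (labels P) (IsNROBP.read-once N P x)

PositiveThrough : ∀ {n} (Z : BP n) → Fin n → Fin (m Z) → Set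
PositiveThrough Z z u =
  ∀ (P₁ : Path Z (source Z) u) (P₂ : Path Z u (sink Z)) → (z , true) ∈ (labels P₁ ++ labels P₂)

clausePositive : ∀ {n} (F : BoolFun n) (Z : BP n) → IsNROBP Z → Represents Z F →
  (u : Fin (m Z)) (x y : Fin n) → (∀ a → F a → (a x ≡ true) ⊎ (a y ≡ true)) →
  Before Z x u → After Z y u →
  Σ (Fin n) λ z → ((z ≡ x) ⊎ (z ≡ y)) × PositiveThrough Z z u
clausePositive F Z N rep u x y clause x-before y-after
  with pathWith? Z N (source Z) u (x , false)
... | no ¬negPrefix = x , inj₁ refl , xPositive
  where
    xPositive : PositiveThrough Z x u
    xPositive Q₁ Q₂ with x-before Q₁ Q₂
    ... | true  , x∈Q₁ = ∈-++⁺ˡ x∈Q₁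
    ... | false , ¬x∈Q₁ = ⊥-elim (¬negPrefix (Q₁ , ¬x∈Q₁))
... | yes (P₁ , ¬x∈P₁) = y , inj₂ refl , yPositive
  where
    yPositive : PositiveThrough Z y u
    yPositive Q₁ Q₂ with y-after P₁ Q₂
    ... | b , y∈Q₂ = ∈-++⁺ʳ (labels Q₁) (subst (λ c → (y , c) ∈ labels Q₂) b≡true y∈Q₂)
      where
        onPath : ∀ {l} → l ∈ labels P₁ ++ labels Q₂ → l ∈ labels (_++ᴾ_ Z P₁ Q₂)
        onPath = subst (_ ∈_) (sym (labels-++ Z P₁ Q₂))
        b≡true : b ≡ true
        b≡true with pathSatisfies F Z N rep (_++ᴾ_ Z P₁ Q₂)
        ... | a , Fa , agrees with clause a Fa
        ...   | inj₁ ax≡true with trans (sym ax≡true) (agrees (onPath (∈-++⁺ˡ ¬x∈P₁)))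
        ...     | ()
        b≡true | a , Fa , agrees | inj₂ ay≡true =
          trans (sym (agrees (onPath (∈-++⁺ʳ (labels P₁) y∈Q₂)))) ay≡true

clausePositive-separated : ∀ {n} (F : BoolFun n) (Z : BP n) → IsNROBP Z → Represents Z F →
  (u : Fin (m Z)) (x y : Fin n) → (∀ a → F a → (a x ≡ true) ⊎ (a y ≡ true)) →
  (Before Z x u × After Z y u) ⊎ (After Z x u × Before Z y u) →
  Σ (Fin n) λ z → ((z ≡ x) ⊎ (z ≡ y)) × PositiveThrough Z z u
clausePositive-separated F Z N rep u x y clause (inj₁ (x-before , y-after)) =
  clausePositive F Z N rep u x y clause x-before y-after
clausePositive-separated F Z N rep u x y clause (inj₂ (x-after , y-before))
  with clausePositive F Z N rep u y x (λ a Fa → swap (clause a Fa)) y-before x-after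
... | z , z∈yx , positive = z , swap z∈yx , positive

orientation : ∀ {n q} {Z : BP n} {xs ys : Fin q → Fin n} {u : Fin (m Z)} →
  Separated Z xs ys u → ∀ i →
  (Before Z (xs i) u × After Z (ys i) u) ⊎ (After Z (xs i) u × Before Z (ys i) u)
orientation (inj₁ (xs-before , ys-after)) i = inj₁ (xs-before i , ys-after i)
orientation (inj₂ (xs-after , ys-before)) i = inj₂ (xs-after i , ys-before i)

proposition2 : ∀ {n q : ℕ} (G : Graph n) → NoIsolated G →
    (F : BoolFun n) → F ⊆F φ G →
    (Z : BP n) → IsNROBP Z → Represents Z F →
    (u : Fin (m Z)) (xs ys : Fin q → Fin n) →
    IsMatching G xs ys → Separated Z xs ys u →
    Σ (Fin q → Fin n) λ X → ((∀ i → (X i ≡ xs i) ⊎ (X i ≡ ys i)) ×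
      (∀ (P₁ : Path Z (source Z) u) (P₂ : Path Z u (sink Z)) (i : Fin q) →
        (X i , true) ∈ (labels P₁ ++ labels P₂)))
proposition2 G _ F F⊆φ Z N rep u xs ys (edge , _) separated =
  (λ i → proj₁ (choice i)) , (λ i → proj₁ (proj₂ (choice i))) ,
  (λ P₁ P₂ i → proj₂ (proj₂ (choice i)) P₁ P₂)
  where
    choice : ∀ i → Σ (Fin _) λ z → ((z ≡ xs i) ⊎ (z ≡ ys i)) × PositiveThrough Z z u
    choice i = clausePositive-separated F Z N rep u (xs i) (ys i)
                 (λ a Fa → F⊆φ a Fa (xs i) (ys i) (edge i)) (orientation separated i)
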